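{- Let $p\ge1$, $d=4p+3$, and let $V$ and $W$ be binary partial words of length $p$. Let $\gamma_W=11\,\mu(W^R)\,010\,\diamondsuit^{d}$, where $W^R$ is the reverse of $W$. Then $S=11h(V)0$ covers $\gamma_W$ if and only if $V\not\approx W$. Here $h(0)=0100$, $h(1)=0001$, $h(\diamondsuit)=0000$, and $\mu(0)=\diamondsuit\diamondsuit0\diamondsuit$, $\mu(1)=0\diamondsuit\diamondsuit\diamondsuit$, $\mu(\diamondsuit)=0\diamondsuit0\diamondsuit$ (extended to words letterwise).
   Context: Binary partial words are strings over $\{0,1,\diamondsuit\}$, where $\diamondsuit$ is a don't care symbol matching both $0$ and $1$; a solid string contains no $\diamondsuit$. Two partial words $U,V$ match ($U\approx V$) if $|U|=|V|$ and for each $i$, $U[i]=V[i]$ or one of them is $\diamondsuit$. Exponents denote repetition. A solid string $S$ occurs in a partial word $T$ at position $j$ if $S\approx T[j..j+|S|-1]$; $S$ covers $T$ if every position $i$ of $T$ lies inside some occurrence of $S$ (an occurrence starting in $\{i-|S|+1,\ldots,i\}$). -}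

module Defs where

open import Data.Bool using (Bool; true; false)
open import Data.Nat using (ℕ; zero; suc; _+_; _*_; _≤_; _<_)
open import Data.List using (List; []; _∷_; _++_; length; reverse; replicate; concatMap; drop; take)
open import Data.Product using (Σ; _×_; ∃-syntax)
open import Relation.Binary.PropositionalEquality using (_≡_)

data Letter : Set where
  𝟎 𝟏 ◇ : Letter

PWord : Set
PWord = List Letter

data _≈ₗ_ : Letter → Letter → Set where
  0≈0 : 𝟎 ≈ₗ 𝟎
  1≈1 : 𝟏 ≈ₗ 𝟏
  ◇≈x : ∀ {x} → ◇ ≈ₗ x
  x≈◇ : ∀ {x} → x ≈ₗ ◇

data _≈_ : PWord → PWord → Set where
  []≈[] : [] ≈ []
  _∷≈_  : ∀ {a b u v} → a ≈ₗ b → u ≈ v → (a ∷ u) ≈ (b ∷ v)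

Solid : Set
Solid = List Bool

toLetter : Bool → Letter
toLetter false = 𝟎
toLetter true  = 𝟏

embed : Solid → PWord
embed [] = []
embed (b ∷ s) = toLetter b ∷ embed s

OccursAt : Solid → PWord → ℕ → Set
OccursAt S T j = (j + length S ≤ length T) × (embed S ≈ take (length S) (drop j T))

Covers : Solid → PWord → Set
Covers S T = ∀ i → i < length T →
  ∃[ j ] (j ≤ i × i < j + length S × OccursAt S T j)

hₗ : Letter → Solid
hₗ 𝟎 = false ∷ true ∷ false ∷ false ∷ []
hₗ 𝟏 = false ∷ false ∷ false ∷ true ∷ []
hₗ ◇ = false ∷ false ∷ false ∷ false ∷ []

h : PWord → Solid
h = concatMap hₗ

μₗ : Letter → PWord
μₗ 𝟎 = ◇ ∷ ◇ ∷ 𝟎 ∷ ◇ ∷ []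
μₗ 𝟏 = 𝟎 ∷ ◇ ∷ ◇ ∷ ◇ ∷ []
μₗ ◇ = 𝟎 ∷ ◇ ∷ 𝟎 ∷ ◇ ∷ []

μ : PWord → PWord
μ = concatMap μₗ

γ : ℕ → PWord → PWord
γ d W = 𝟏 ∷ 𝟏 ∷ (μ (reverse W) ++ (𝟎 ∷ 𝟏 ∷ 𝟎 ∷ replicate d ◇))

S-of : PWord → Solid
S-of V = true ∷ true ∷ (h V ++ (false ∷ []))

-- If V ≉ W, some position carries 0 in one word and 1 in the other. Three occurrences of S then
-- cover γ_W: one at the start (every h-block fits under every μ-block), one on the trailing holes,
-- and one across 010, placed so that the conflicting blocks meet and the single 1 of the h-block
-- of V's letter lands on the 1 of 010, while the h-blocks before it slide over μ-blocks.
-- If V ≈ W, no occurrence covers the last 0 of 010: the leading 1 of S would sit in the μ-block of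
-- some letter c of W while the 1 of 010 meets the h-block of the matching letter a ≈ c of V,
-- and no such pair of blocks admits both 1s.
module Submission where

open import Defs
open import Data.Bool using (false)
open import Data.Empty using (⊥; ⊥-elim)
open import Data.List using (List; []; _∷_; _++_; length; reverse; replicate; take; drop; concatMap)
open import Data.List.Properties using (++-assoc; concatMap-++; length-++; length-++-≤ʳ; length-replicate; length-reverse; reverse-++; unfold-reverse)
open import Data.Nat using (ℕ; zero; suc; _+_; _*_; _∸_; _≤_; _<_; z≤n; s≤s)
open import Data.Nat.DivMod using (_/_; _%_; m≡m%n+[m/n]*n; m%n<n; m<n*o⇒m/o<n)
open import Data.Nat.Properties
  using (≤-refl; ≤-trans; ≤-reflexive; ≤-antisym; ≤-pred; <-≤-trans; ≮⇒≥; _<?_; +-comm; +-assoc; +-suc; +-identityʳ;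
         +-monoʳ-≤; +-monoˡ-≤; *-monoˡ-≤; <⇒≤; module ≤-Reasoning; +-cancelˡ-≤; +-cancelʳ-≤; +-cancelʳ-≡; n≤1+n; m≤m+n; m≤n+m; m+[n∸m]≡n; suc-injective)
open import Data.Nat.Tactic.RingSolver using (solve-∀)
open import Data.Product using (_×_; _,_; ∃-syntax)
open import Data.Sum using (_⊎_; inj₁; inj₂)
open import Function using (_∘_)
open import Function.Bundles using (_⇔_; mk⇔)
open import Relation.Binary.PropositionalEquality
open import Relation.Nullary using (¬_; yes; no)

private variable
  a b c z z′ : Letter
  u v t T V W W₂ : PWord
  S : Solid
  d j k m n : ℕ

infixl 30 _!_
-- Reading past the end yields ◇, which is compatible with every letter.
_!_ : PWord → ℕ → Letter
[] ! _ = ◇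
(x ∷ _) ! zero = x
(_ ∷ xs) ! suc m = xs ! m

!-++ʳ : ∀ (x : PWord) {y} m → length x ≡ n → (x ++ y) ! (n + m) ≡ y ! m
!-++ʳ [] m refl = refl
!-++ʳ (_ ∷ x) m refl = !-++ʳ x m refl

!-take : ∀ n (L : PWord) → m < n → take n L ! m ≡ L ! m
!-take (suc n) [] _ = refl
!-take {zero} (suc n) (_ ∷ L) _ = refl
!-take {suc m} (suc n) (_ ∷ L) (s≤s m<n) = !-take n L m<n

!-drop : ∀ j (L : PWord) m → drop j L ! m ≡ L ! (j + m)
!-drop zero L m = refl
!-drop (suc j) [] m = refl
!-drop (suc j) (_ ∷ L) m = !-drop j L m

!-beyond : ∀ (L : PWord) → length L ≤ m → L ! m ≡ ◇
!-beyond [] _ = refl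
!-beyond (_ ∷ L) (s≤s le) = !-beyond L le

≈⇒!≈ₗ : u ≈ v → ∀ m → u ! m ≈ₗ v ! m
≈⇒!≈ₗ []≈[] m = ◇≈x
≈⇒!≈ₗ (e ∷≈ _) zero = e
≈⇒!≈ₗ (_ ∷≈ r) (suc m) = ≈⇒!≈ₗ r m

𝟏≉𝟎 : ¬ 𝟏 ≈ₗ 𝟎
𝟏≉𝟎 ()

infix 4 _≲_
infixr 5 _∷≲_
data _≲_ : PWord → PWord → Set where
  []≲  : [] ≲ t
  _∷≲_ : a ≈ₗ b → u ≲ t → a ∷ u ≲ b ∷ t

≲-length : u ≲ t → length u ≤ length t
≲-length []≲ = z≤n
≲-length (_ ∷≲ r) = s≤s (≲-length r)

≲⇒≈-take : u ≲ t → u ≈ take (length u) t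
≲⇒≈-take []≲ = []≈[]
≲⇒≈-take (e ∷≲ r) = e ∷≈ ≲⇒≈-take r

≲-replicate-◇ : ∀ u → length u ≤ n → u ≲ replicate n ◇
≲-replicate-◇ [] _ = []≲
≲-replicate-◇ (_ ∷ u) (s≤s le) = x≈◇ ∷≲ ≲-replicate-◇ u le

length-embed : ∀ s → length (embed s) ≡ length s
length-embed [] = refl
length-embed (_ ∷ s) = cong suc (length-embed s)

embed-++ : ∀ s s′ → embed (s ++ s′) ≡ embed s ++ embed s′
embed-++ [] s′ = refl
embed-++ (x ∷ s) s′ = cong (toLetter x ∷_) (embed-++ s s′)

≲⇒occurs-at-0 : embed S ≲ T → OccursAt S T 0
≲⇒occurs-at-0 {S} r rewrite sym (length-embed S) = ≲-length r , ≲⇒≈-take r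

occurs-++ : ∀ x {j} → OccursAt S T j → OccursAt S (x ++ T) (length x + j)
occurs-++ [] o = o
occurs-++ (_ ∷ x) o with occurs-++ x o
... | fits , window = s≤s fits , window

occurs⇒!≈ₗ : OccursAt S T j → ∀ m → embed S ! m ≈ₗ T ! (j + m)
occurs⇒!≈ₗ {S} {T} {j} (_ , window) m with m <? length S
... | yes m<S = subst (embed S ! m ≈ₗ_) (trans (!-take _ (drop j T) m<S) (!-drop j T m)) (≈⇒!≈ₗ window m)
... | no m≮S = subst (_≈ₗ T ! (j + m)) (sym (!-beyond (embed S) S≤m)) ◇≈x
  where S≤m = subst (_≤ m) (sym (length-embed S)) (≮⇒≥ m≮S)

covers-by-three : OccursAt S T 0 → OccursAt S T j → OccursAt S T k →
  j ≤ length S → k ≤ j + length S → length T ≤ k + length S → Covers S T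
covers-by-three {S} {j = j} {k} o₀ oⱼ oₖ j≤S k≤j+S T≤k+S i i<T with i <? length S | i <? j + length S
... | yes i<S | _ = 0 , z≤n , i<S , o₀
... | no i≮S | yes i<j+S = j , ≤-trans j≤S (≮⇒≥ i≮S) , i<j+S , oⱼ
... | no _ | no i≮j+S = k , ≤-trans k≤j+S (≮⇒≥ i≮j+S) , <-≤-trans i<T T≤k+S , oₖ

length-concatMap : ∀ {A B : Set} (f : A → List B) → (∀ x → length (f x) ≡ n) →
  ∀ xs → length (concatMap f xs) ≡ length xs * n
length-concatMap f len-f [] = refl
length-concatMap f len-f (x ∷ xs) =
  trans (length-++ (f x)) (cong₂ _+_ (len-f x) (length-concatMap f len-f xs))

length-h : ∀ V → length (h V) ≡ length V * 4
length-h = length-concatMap hₗ λ { 𝟎 → refl ; 𝟏 → refl ; ◇ → refl }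

length-μ-reverse : ∀ W → length (μ (reverse W)) ≡ length W * 4
length-μ-reverse W =
  trans (length-concatMap μₗ (λ { 𝟎 → refl ; 𝟏 → refl ; ◇ → refl }) (reverse W)) (cong (_* 4) (length-reverse W))

length-S-of : ∀ V → length (S-of V) ≡ 2 + (length V * 4 + 1)
length-S-of V = cong (2 +_) (trans (length-++ (h V)) (cong (_+ 1) (length-h V)))

embed-S-of : ∀ V → embed (S-of V) ≡ 𝟏 ∷ 𝟏 ∷ embed (h V) ++ 𝟎 ∷ []
embed-S-of V = cong (λ w → 𝟏 ∷ 𝟏 ∷ w) (embed-++ (h V) (false ∷ []))

embed-S-of-split : ∀ V₁ a V₂ →
  embed (S-of (V₁ ++ a ∷ V₂)) ≡ 𝟏 ∷ 𝟏 ∷ embed (h V₁) ++ embed (hₗ a) ++ embed (h V₂) ++ 𝟎 ∷ []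
embed-S-of-split V₁ a V₂ = trans (embed-S-of (V₁ ++ a ∷ V₂)) (cong (λ w → 𝟏 ∷ 𝟏 ∷ w) (begin
  embed (h (V₁ ++ a ∷ V₂)) ++ 𝟎 ∷ []
    ≡⟨ cong (λ w → embed w ++ 𝟎 ∷ []) (concatMap-++ hₗ V₁ (a ∷ V₂)) ⟩
  embed (h V₁ ++ hₗ a ++ h V₂) ++ 𝟎 ∷ []
    ≡⟨ cong (_++ 𝟎 ∷ []) (trans (embed-++ (h V₁) _) (cong (embed (h V₁) ++_) (embed-++ (hₗ a) (h V₂)))) ⟩
  (embed (h V₁) ++ embed (hₗ a) ++ embed (h V₂)) ++ 𝟎 ∷ []
    ≡⟨ ++-assoc (embed (h V₁)) _ _ ⟩
  embed (h V₁) ++ (embed (hₗ a) ++ embed (h V₂)) ++ 𝟎 ∷ []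
    ≡⟨ cong (embed (h V₁) ++_) (++-assoc (embed (hₗ a)) _ _) ⟩
  embed (h V₁) ++ embed (hₗ a) ++ embed (h V₂) ++ 𝟎 ∷ [] ∎))
  where open ≡-Reasoning

γ-tail : ℕ → PWord
γ-tail d = 𝟎 ∷ 𝟏 ∷ 𝟎 ∷ replicate d ◇

γ-split : ∀ d W₁ c W₂ → γ d (W₁ ++ c ∷ W₂) ≡ (𝟏 ∷ 𝟏 ∷ μ (reverse W₂)) ++ μₗ c ++ μ (reverse W₁) ++ γ-tail d
γ-split d W₁ c W₂ = cong (λ w → 𝟏 ∷ 𝟏 ∷ w) (begin
  μ (reverse (W₁ ++ c ∷ W₂)) ++ γ-tail d
    ≡⟨ cong (λ w → μ w ++ γ-tail d) reverse-split ⟩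
  μ (reverse W₂ ++ c ∷ reverse W₁) ++ γ-tail d
    ≡⟨ cong (_++ γ-tail d) (concatMap-++ μₗ (reverse W₂) (c ∷ reverse W₁)) ⟩
  (μ (reverse W₂) ++ μₗ c ++ μ (reverse W₁)) ++ γ-tail d
    ≡⟨ ++-assoc (μ (reverse W₂)) _ _ ⟩
  μ (reverse W₂) ++ (μₗ c ++ μ (reverse W₁)) ++ γ-tail d
    ≡⟨ cong (μ (reverse W₂) ++_) (++-assoc (μₗ c) _ _) ⟩
  μ (reverse W₂) ++ μₗ c ++ μ (reverse W₁) ++ γ-tail d ∎)
  where
  open ≡-Reasoning
  reverse-split : reverse (W₁ ++ c ∷ W₂) ≡ reverse W₂ ++ c ∷ reverse W₁
  reverse-split = trans (reverse-++ W₁ (c ∷ W₂))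
    (trans (cong (_++ reverse W₁) (unfold-reverse c W₂)) (++-assoc (reverse W₂) (c ∷ []) (reverse W₁)))

γ-!-block : ∀ d W₁ c W₂ r → j ≡ 2 + (length W₂ * 4 + r) →
  γ d (W₁ ++ c ∷ W₂) ! j ≡ (μₗ c ++ μ (reverse W₁) ++ γ-tail d) ! r
γ-!-block {j} d W₁ c W₂ r refl = trans (cong (_! j) (γ-split d W₁ c W₂))
  (!-++ʳ (𝟏 ∷ 𝟏 ∷ μ (reverse W₂)) {μₗ c ++ μ (reverse W₁) ++ γ-tail d} r (cong (2 +_) (length-μ-reverse W₂)))

γ-!-tail : ∀ d W t → j ≡ 2 + (length W * 4 + t) → γ d W ! j ≡ γ-tail d ! t
γ-!-tail d W t refl = !-++ʳ (𝟏 ∷ 𝟏 ∷ μ (reverse W)) {γ-tail d} t (cong (2 +_) (length-μ-reverse W))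

γ-prefix : PWord → PWord
γ-prefix W = 𝟏 ∷ 𝟏 ∷ μ (reverse W) ++ 𝟎 ∷ 𝟏 ∷ 𝟎 ∷ []

γ≡γ-prefix++◇ : ∀ d W → γ d W ≡ γ-prefix W ++ replicate d ◇
γ≡γ-prefix++◇ d W = cong (λ w → 𝟏 ∷ 𝟏 ∷ w) (sym (++-assoc (μ (reverse W)) (𝟎 ∷ 𝟏 ∷ 𝟎 ∷ []) (replicate d ◇)))

length-γ-prefix : ∀ V W → length V ≡ length W → length (γ-prefix W) ≡ 2 + length (S-of V)
length-γ-prefix V W eq = begin
  length (γ-prefix W)                    ≡⟨ cong (2 +_) (length-++ (μ (reverse W))) ⟩
  2 + (length (μ (reverse W)) + 3)       ≡⟨ cong (λ n → 2 + (n + 3)) (length-μ-reverse W) ⟩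
  2 + (length W * 4 + 3)                 ≡⟨ cong (λ n → 2 + (n * 4 + 3)) (sym eq) ⟩
  2 + (length V * 4 + 3)                 ≡⟨ cong (2 +_) (sym (+-assoc (length V * 4) 1 2)) ⟩
  2 + (length V * 4 + 1 + 2)             ≡⟨ cong (2 +_) (+-comm (length V * 4 + 1) 2) ⟩
  2 + (2 + (length V * 4 + 1))           ≡⟨ cong (2 +_) (sym (length-S-of V)) ⟩
  2 + length (S-of V)                    ∎
  where open ≡-Reasoning

length-γ : ∀ d W → length (γ d W) ≡ length (γ-prefix W) + d
length-γ d W = trans (cong length (γ≡γ-prefix++◇ d W))
  (trans (length-++ (γ-prefix W)) (cong (length (γ-prefix W) +_) (length-replicate d)))

-- Every h-block reads 0?0? and every μ-block reads x◇y◇ with x, y compatible with 0, so an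
-- h-block fits under a μ-block, and also under the last two letters of one μ-block followed
-- by the first two of the next.
μ₀ μ₂ : Letter → Letter
μ₀ 𝟎 = ◇
μ₀ 𝟏 = 𝟎
μ₀ ◇ = 𝟎
μ₂ 𝟎 = 𝟎
μ₂ 𝟏 = ◇
μ₂ ◇ = 𝟎

μₗ-++ : ∀ b (M v : PWord) → (μₗ b ++ M) ++ v ≡ μ₀ b ∷ ◇ ∷ μ₂ b ∷ ◇ ∷ M ++ v
μₗ-++ 𝟎 M v = refl
μₗ-++ 𝟏 M v = refl
μₗ-++ ◇ M v = refl

𝟎≈μ₀ : ∀ b → 𝟎 ≈ₗ μ₀ b
𝟎≈μ₀ 𝟎 = x≈◇
𝟎≈μ₀ 𝟏 = 0≈0
𝟎≈μ₀ ◇ = 0≈0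

𝟎≈μ₂ : ∀ b → 𝟎 ≈ₗ μ₂ b
𝟎≈μ₂ 𝟎 = 0≈0
𝟎≈μ₂ 𝟏 = x≈◇
𝟎≈μ₂ ◇ = 0≈0

hₗ≲ : ∀ a X → 𝟎 ≈ₗ z → 𝟎 ≈ₗ z′ → embed X ++ u ≲ v → embed (hₗ a ++ X) ++ u ≲ z ∷ ◇ ∷ z′ ∷ ◇ ∷ v
hₗ≲ 𝟎 X e e′ r = e ∷≲ x≈◇ ∷≲ e′ ∷≲ x≈◇ ∷≲ r
hₗ≲ 𝟏 X e e′ r = e ∷≲ x≈◇ ∷≲ e′ ∷≲ x≈◇ ∷≲ r
hₗ≲ ◇ X e e′ r = e ∷≲ x≈◇ ∷≲ e′ ∷≲ x≈◇ ∷≲ r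

h≲μ : ∀ V W → length V ≡ length W → u ≲ v → embed (h V) ++ u ≲ μ W ++ v
h≲μ [] [] _ r = r
h≲μ {v = v} (a ∷ V) (b ∷ W) eq r rewrite μₗ-++ b (μ W) v =
  hₗ≲ a (h V) (𝟎≈μ₀ b) (𝟎≈μ₂ b) (h≲μ V W (suc-injective eq) r)

h≲◇μ : ∀ V W → length V ≡ length W → 𝟎 ≈ₗ z → u ≲ v → embed (h V) ++ 𝟎 ∷ 𝟎 ∷ u ≲ z ∷ ◇ ∷ μ W ++ v
h≲◇μ [] [] _ e r = e ∷≲ x≈◇ ∷≲ r
h≲◇μ {v = v} (a ∷ V) (b ∷ W) eq e r rewrite μₗ-++ b (μ W) v =
  hₗ≲ a (h V) e (𝟎≈μ₀ b) (h≲◇μ V W (suc-injective eq) (𝟎≈μ₂ b) r)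

h𝟎≲◇* : ∀ V → length V * 4 ≤ n → 𝟎 ≈ₗ z → embed (h V) ++ 𝟎 ∷ [] ≲ z ∷ replicate n ◇
h𝟎≲◇* [] _ e = e ∷≲ []≲
h𝟎≲◇* (a ∷ V) (s≤s (s≤s (s≤s (s≤s le)))) e = hₗ≲ a (h V) e x≈◇ (h𝟎≲◇* V le x≈◇)

data Conflict : Letter → Letter → Set where
  0≁1 : Conflict 𝟎 𝟏
  1≁0 : Conflict 𝟏 𝟎

compatible-or-conflict : ∀ a b → a ≈ₗ b ⊎ Conflict a b
compatible-or-conflict 𝟎 𝟎 = inj₁ 0≈0
compatible-or-conflict 𝟎 𝟏 = inj₂ 0≁1
compatible-or-conflict 𝟏 𝟎 = inj₂ 1≁0
compatible-or-conflict 𝟏 𝟏 = inj₁ 1≈1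
compatible-or-conflict ◇ _ = inj₁ ◇≈x
compatible-or-conflict 𝟎 ◇ = inj₁ x≈◇
compatible-or-conflict 𝟏 ◇ = inj₁ x≈◇

data Mismatch : PWord → PWord → Set where
  mismatch : ∀ V₁ V₂ W₁ W₂ → length V₁ ≡ length W₁ → length V₂ ≡ length W₂ → Conflict a b →
    Mismatch (V₁ ++ a ∷ V₂) (W₁ ++ b ∷ W₂)

mismatch-∷ : Mismatch V W → Mismatch (a ∷ V) (b ∷ W)
mismatch-∷ {a = a} {b = b} (mismatch V₁ V₂ W₁ W₂ l₁ l₂ conflict) =
  mismatch (a ∷ V₁) V₂ (b ∷ W₁) W₂ (cong suc l₁) l₂ conflict

≉⇒mismatch : ∀ V W → length V ≡ length W → ¬ V ≈ W → Mismatch V W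
≉⇒mismatch [] [] _ V≉W = ⊥-elim (V≉W []≈[])
≉⇒mismatch (a ∷ V) (b ∷ W) eq V≉W with compatible-or-conflict a b
... | inj₂ conflict = mismatch [] V [] W refl (suc-injective eq) conflict
... | inj₁ a≈b = mismatch-∷ (≉⇒mismatch V W (suc-injective eq) (V≉W ∘ (a≈b ∷≈_)))

-- For a conflict 0/1 the word S slides in halfway through μ(1) = 0◇◇◇ so that h(0) = 0100 lies
-- under 010◇; for 1/0 it starts on μ(0) = ◇◇0◇, shifting every h-block by two, and the last
-- two letters of h(1) = 0001 lie under 01.
conflict-fit : ∀ V₁ V₂ W₁ → length V₁ ≡ length W₁ → 2 + length V₂ * 4 ≤ d → Conflict a b →
  ∃[ e ] (e ≤ 2 × OccursAt (S-of (V₁ ++ a ∷ V₂)) (μₗ b ++ μ (reverse W₁) ++ γ-tail d) e)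
conflict-fit {d} V₁ V₂ W₁ l₁ (s≤s (s≤s le)) 0≁1 = 2 , ≤-refl , occurs-++ (𝟎 ∷ ◇ ∷ []) {j = 0} (≲⇒occurs-at-0
  (subst (_≲ ◇ ∷ ◇ ∷ μ (reverse W₁) ++ γ-tail d) (sym (embed-S-of-split V₁ 𝟎 V₂))
    (x≈◇ ∷≲ x≈◇ ∷≲ h≲μ V₁ (reverse W₁) (trans l₁ (sym (length-reverse W₁)))
      (0≈0 ∷≲ 1≈1 ∷≲ 0≈0 ∷≲ x≈◇ ∷≲ h𝟎≲◇* V₂ le x≈◇))))
conflict-fit {d} V₁ V₂ W₁ l₁ le 1≁0 = 0 , z≤n , ≲⇒occurs-at-0
  (subst (_≲ μₗ 𝟎 ++ μ (reverse W₁) ++ γ-tail d) (sym (embed-S-of-split V₁ 𝟏 V₂))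
    (x≈◇ ∷≲ x≈◇ ∷≲ h≲◇μ V₁ (reverse W₁) (trans l₁ (sym (length-reverse W₁))) 0≈0
      (0≈0 ∷≲ 1≈1 ∷≲ h𝟎≲◇* V₂ (≤-trans (m≤n+m _ 2) le) 0≈0)))

m<n⇒m*4+k≤n*4 : m < n → k ≤ 4 → m * 4 + k ≤ n * 4
m<n⇒m*4+k≤n*4 {m} {n} m<n k≤4 = ≤-trans (+-monoʳ-≤ (m * 4) k≤4) (subst (_≤ n * 4) (+-comm 4 (m * 4)) (*-monoˡ-≤ 4 m<n))

length-suffix< : ∀ V₁ (a : Letter) V₂ → length V₂ < length (V₁ ++ a ∷ V₂)
length-suffix< V₁ a V₂ = length-++-≤ʳ (a ∷ V₂) {V₁}

mismatch⇒occurs : Mismatch V W → 2 + length V * 4 ≤ d →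
  ∃[ j ] (2 ≤ j × j ≤ length (S-of V) × OccursAt (S-of V) (γ d W) j)
mismatch⇒occurs {d = d} (mismatch {a} {b} V₁ V₂ W₁ W₂ l₁ l₂ conflict) V≤d
  with conflict-fit {d} V₁ V₂ W₁ l₁ (≤-trans (+-monoʳ-≤ 2 (*-monoˡ-≤ 4 (<⇒≤ (length-suffix< V₁ a V₂)))) V≤d) conflict
... | e , e≤2 , o = length P + e , s≤s (s≤s z≤n) , j≤S ,
  subst (λ T → OccursAt (S-of (V₁ ++ a ∷ V₂)) T (length P + e)) (sym (γ-split d W₁ b W₂)) (occurs-++ P o)
  where
  P = 𝟏 ∷ 𝟏 ∷ μ (reverse W₂)
  j≤S : length P + e ≤ length (S-of (V₁ ++ a ∷ V₂))
  j≤S = subst (length P + e ≤_) (sym (length-S-of (V₁ ++ a ∷ V₂))) (s≤s (s≤s (begin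
    length (μ (reverse W₂)) + e ≡⟨ cong (_+ e) (trans (length-μ-reverse W₂) (cong (_* 4) (sym l₂))) ⟩
    length V₂ * 4 + e           ≤⟨ m<n⇒m*4+k≤n*4 (length-suffix< V₁ a V₂) (≤-trans e≤2 (s≤s (s≤s z≤n))) ⟩
    length (V₁ ++ a ∷ V₂) * 4   ≤⟨ m≤m+n _ 1 ⟩
    length (V₁ ++ a ∷ V₂) * 4 + 1 ∎)))
    where open ≤-Reasoning

occurs-at-start : length V ≡ length W → OccursAt (S-of V) (γ d W) 0
occurs-at-start {V} {W} {d} eq = ≲⇒occurs-at-0 (subst (_≲ γ d W) (sym (embed-S-of V))
  (1≈1 ∷≲ 1≈1 ∷≲ h≲μ V (reverse W) (trans eq (sym (length-reverse W))) (0≈0 ∷≲ []≲)))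

occurs-at-end : ∀ W → OccursAt (S-of V) (γ (length (S-of V)) W) (length (γ-prefix W))
occurs-at-end {V} W = subst₂ (OccursAt (S-of V)) (sym (γ≡γ-prefix++◇ _ W)) (+-identityʳ (length (γ-prefix W)))
  (occurs-++ (γ-prefix W) {j = 0} (≲⇒occurs-at-0 (≲-replicate-◇ _ (≤-reflexive (length-embed (S-of V))))))

≉⇒covers : length V ≡ length W → ¬ V ≈ W → Covers (S-of V) (γ (length (S-of V)) W)
≉⇒covers {V} {W} eq V≉W with mismatch⇒occurs (≉⇒mismatch V W eq V≉W) V≤S
  where
  V≤S : 2 + length V * 4 ≤ length (S-of V)
  V≤S = subst (2 + length V * 4 ≤_) (sym (length-S-of V)) (+-monoʳ-≤ 2 (m≤m+n _ 1))
... | j , 2≤j , j≤S , oⱼ =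
  covers-by-three (occurs-at-start {V} {W} eq) oⱼ (occurs-at-end {V} W) j≤S prefix≤j+S γ≤prefix+S
  where
  prefix≤j+S : length (γ-prefix W) ≤ j + length (S-of V)
  prefix≤j+S = subst (_≤ j + length (S-of V)) (sym (length-γ-prefix V W eq)) (+-monoˡ-≤ (length (S-of V)) 2≤j)
  γ≤prefix+S : length (γ (length (S-of V)) W) ≤ length (γ-prefix W) + length (S-of V)
  γ≤prefix+S = ≤-reflexive (length-γ _ W)

block-position : ∀ n k → k ≤ n * 4 + 2 →
  (∃[ B ] ∃[ r ] (B < n × r < 4 × k ≡ B * 4 + r)) ⊎ (∃[ t ] (t < 3 × k ≡ n * 4 + t))
block-position n k k≤ with k / 4 <? n
... | yes q<n = inj₁ (k / 4 , k % 4 , q<n , m%n<n k 4 , trans (m≡m%n+[m/n]*n k 4) (+-comm (k % 4) _))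
... | no q≮n = inj₂ (k % 4 , s≤s (+-cancelˡ-≤ (n * 4) _ _ (subst (_≤ n * 4 + 2) k≡ k≤)) , k≡)
  where
  k<[n+1]*4 : k < suc n * 4
  k<[n+1]*4 = s≤s (subst (k ≤_) (+-comm (n * 4) 3) (≤-trans k≤ (+-monoʳ-≤ (n * 4) (n≤1+n 2))))
  q≡n : k / 4 ≡ n
  q≡n = ≤-antisym (≤-pred (m<n*o⇒m/o<n k<[n+1]*4)) (≮⇒≥ q≮n)
  k≡ : k ≡ n * 4 + k % 4
  k≡ = trans (m≡m%n+[m/n]*n k 4) (trans (+-comm (k % 4) _) (cong (λ q → q * 4 + k % 4) q≡n))

splitʳ : ∀ (W : PWord) B → B < length W → ∃[ W₁ ] ∃[ c ] ∃[ W₂ ] (W ≡ W₁ ++ c ∷ W₂ × length W₂ ≡ B)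
splitʳ (x ∷ W) B B<xW with B <? length W
... | no B≮W = [] , x , W , refl , ≤-antisym (≮⇒≥ B≮W) (≤-pred B<xW)
... | yes B<W with splitʳ W B B<W
...   | W₁ , c , W₂ , refl , l = x ∷ W₁ , c , W₂ , refl , l

≈-split : ∀ W₁ → V ≈ (W₁ ++ c ∷ W₂) →
  ∃[ V₁ ] ∃[ a ] ∃[ V₂ ] (V ≡ V₁ ++ a ∷ V₂ × length V₁ ≡ length W₁ × a ≈ₗ c)
≈-split [] (a≈c ∷≈ _) = [] , _ , _ , refl , refl , a≈c
≈-split (_ ∷ W₁) (_ ∷≈ r) with ≈-split W₁ r
... | V₁ , a , V₂ , refl , l , a≈c = _ ∷ V₁ , a , V₂ , refl , cong suc l , a≈c

-- Only two offsets pair a 1-compatible letter of a μ-block (offset r) with a 1 in the matching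
-- h-block (offset 3 − r): r = 0 needs c = 0 and a = 1, r = 2 needs c = 1 and a = 0.
block-clash : ∀ (Z E : PWord) r s → r + s ≡ 3 → a ≈ₗ c →
  𝟏 ≈ₗ (μₗ c ++ Z) ! r → (embed (hₗ a) ++ E) ! s ≈ₗ 𝟏 → ⊥
block-clash Z E 0 _ refl 0≈0 _ ()
block-clash Z E 0 _ refl 1≈1 () _
block-clash Z E 0 _ refl ◇≈x _ ()
block-clash Z E 0 _ refl x≈◇ () _
block-clash {𝟎} Z E 1 _ refl _ _ ()
block-clash {𝟏} Z E 1 _ refl _ _ ()
block-clash {◇} Z E 1 _ refl _ _ ()
block-clash Z E 2 _ refl 0≈0 () _
block-clash Z E 2 _ refl 1≈1 _ ()
block-clash Z E 2 _ refl ◇≈x _ ()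
block-clash Z E 2 _ refl x≈◇ () _
block-clash {𝟎} Z E 3 _ refl _ _ ()
block-clash {𝟏} Z E 3 _ refl _ _ ()
block-clash {◇} Z E 3 _ refl _ _ ()
block-clash Z E (suc (suc (suc (suc _)))) _ () _ _ _

block-offset-sum : ∀ B L r s → (2 + (B * 4 + r)) + (2 + (L * 4 + s)) + 3 ≡ 2 + ((L + suc B) * 4 + 1) + (r + s)
block-offset-sum = solve-∀

¬occurs-in-block : ∀ V₁ a V₂ W₁ c W₂ r → length V₁ ≡ length W₁ → a ≈ₗ c → r < 4 →
  ¬ OccursAt (S-of (V₁ ++ a ∷ V₂)) (γ d (W₁ ++ c ∷ W₂)) (2 + (length W₂ * 4 + r))
¬occurs-in-block {d} V₁ a V₂ W₁ c W₂ r l₁ a≈c r<4 o =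
  block-clash (μ (reverse W₁) ++ γ-tail d) (embed (h V₂) ++ 𝟎 ∷ []) r s r+s≡3 a≈c S₀-over-block Sₘ-over-1
  where
  s = 3 ∸ r
  r+s≡3 : r + s ≡ 3
  r+s≡3 = m+[n∸m]≡n (≤-pred r<4)
  start = 2 + (length W₂ * 4 + r)
  offset = 2 + (length V₁ * 4 + s)
  aligned : ∀ m → embed (S-of (V₁ ++ a ∷ V₂)) ! m ≈ₗ γ d (W₁ ++ c ∷ W₂) ! (start + m)
  aligned = occurs⇒!≈ₗ {S-of (V₁ ++ a ∷ V₂)} {γ d (W₁ ++ c ∷ W₂)} {start} o
  S₀-over-block : 𝟏 ≈ₗ (μₗ c ++ μ (reverse W₁) ++ γ-tail d) ! r
  S₀-over-block = subst (𝟏 ≈ₗ_) (γ-!-block d W₁ c W₂ r (+-identityʳ start)) (aligned 0)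
  start+offset≡ : start + offset ≡ 2 + (length (W₁ ++ c ∷ W₂) * 4 + 1)
  start+offset≡ = trans (+-cancelʳ-≡ 3 _ _ (trans (block-offset-sum (length W₂) (length V₁) r s)
      (cong (2 + ((length V₁ + suc (length W₂)) * 4 + 1) +_) r+s≡3)))
    (cong (λ n → 2 + (n * 4 + 1)) (trans (cong (_+ suc (length W₂)) l₁) (sym (length-++ W₁))))
  Sₘ-over-1 : (embed (hₗ a) ++ embed (h V₂) ++ 𝟎 ∷ []) ! s ≈ₗ 𝟏
  Sₘ-over-1 = subst₂ _≈ₗ_
    (trans (cong (_! offset) (embed-S-of-split V₁ a V₂))
      (!-++ʳ (𝟏 ∷ 𝟏 ∷ embed (h V₁)) s (cong (2 +_) (trans (length-embed (h V₁)) (length-h V₁)))))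
    (γ-!-tail d (W₁ ++ c ∷ W₂) 1 start+offset≡)
    (aligned offset)

¬occurs-over-010 : ∀ V W t → t < 3 → ¬ OccursAt (S-of V) (γ d W) (2 + (length W * 4 + t))
¬occurs-over-010 {d} V W 0 _ o = 𝟏≉𝟎 (subst (𝟏 ≈ₗ_) (γ-!-tail d W 0 (+-identityʳ _))
  (occurs⇒!≈ₗ {S-of V} {γ d W} {2 + (length W * 4 + 0)} o 0))
¬occurs-over-010 {d} V W 1 _ o = 𝟏≉𝟎 (subst (𝟏 ≈ₗ_) (γ-!-tail d W 2 (cong (2 +_) (+-assoc (length W * 4) 1 1)))
  (occurs⇒!≈ₗ {S-of V} {γ d W} {2 + (length W * 4 + 1)} o 1))
¬occurs-over-010 {d} V W 2 _ o = 𝟏≉𝟎 (subst (𝟏 ≈ₗ_) (γ-!-tail d W 2 (+-identityʳ _))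
  (occurs⇒!≈ₗ {S-of V} {γ d W} {2 + (length W * 4 + 2)} o 0))
¬occurs-over-010 V W (suc (suc (suc _))) (s≤s (s≤s (s≤s ())))

¬occurs-near-010 : V ≈ W → 2 ≤ j → j ≤ 2 + (length W * 4 + 2) → ¬ OccursAt (S-of V) (γ d W) j
¬occurs-near-010 {V} {W} V≈W (s≤s (s≤s _)) (s≤s (s≤s k≤)) o with block-position (length W) _ k≤
... | inj₂ (t , t<3 , refl) = ¬occurs-over-010 V W t t<3 o
... | inj₁ (B , r , B<n , r<4 , refl) with splitʳ W B B<n
...   | W₁ , c , W₂ , refl , refl with ≈-split W₁ V≈W
...     | V₁ , a , V₂ , refl , l₁ , a≈c = ¬occurs-in-block V₁ a V₂ W₁ c W₂ r l₁ a≈c r<4 o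

covers⇒≉ : length V ≡ length W → V ≈ W → ¬ Covers (S-of V) (γ d W)
covers⇒≉ {V} {W} {d} eq V≈W cov with cov (suc (length (S-of V))) S<γ
  where
  S<γ : suc (length (S-of V)) < length (γ d W)
  S<γ = subst (suc (length (S-of V)) <_) (sym (trans (length-γ d W) (cong (_+ d) (length-γ-prefix V W eq))))
    (m≤m+n (2 + length (S-of V)) d)
... | j , j≤i , i<j+S , o = ¬occurs-near-010 V≈W 2≤j j≤ o
  where
  2≤j : 2 ≤ j
  2≤j = +-cancelʳ-≤ (length (S-of V)) 2 j i<j+S
  j≤ : j ≤ 2 + (length W * 4 + 2)
  j≤ = subst (j ≤_) (begin
    suc (length (S-of V))         ≡⟨ cong suc (length-S-of V) ⟩
    2 + suc (length V * 4 + 1)    ≡⟨ cong (2 +_) (sym (+-suc (length V * 4) 1)) ⟩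
    2 + (length V * 4 + 2)        ≡⟨ cong (λ n → 2 + (n * 4 + 2)) eq ⟩
    2 + (length W * 4 + 2)        ∎) j≤i
    where open ≡-Reasoning

lemma8 : (p : ℕ) → 1 ≤ p → (V W : PWord) → length V ≡ p → length W ≡ p →
    Covers (S-of V) (γ (4 * p + 3) W) ⇔ (¬ (V ≈ W))
lemma8 .(length V) _ V W refl |W|≡p = mk⇔
  (λ covers V≈W → covers⇒≉ eq V≈W covers)
  (λ V≉W → subst (λ d → Covers (S-of V) (γ d W)) |S|≡4p+3 (≉⇒covers eq V≉W))
  where
  eq : length V ≡ length W
  eq = sym |W|≡p
  normalise : ∀ n → 2 + (n * 4 + 1) ≡ 4 * n + 3
  normalise = solve-∀
  |S|≡4p+3 : length (S-of V) ≡ 4 * length V + 3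
  |S|≡4p+3 = trans (length-S-of V) (normalise (length V))
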